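{- Let $n>m\ge 1$ and $d\ge 1$ be integers. If $d \le mn - m(m+1)/2$, then $P(n,m,d)\ge 2$. Moreover, this bound on $d$ is tight: if $d > mn-m(m+1)/2$, then $P(n,m,d) = 1$.
   Context: For permutations $\sigma,\pi$ of $[1\ldots n]=\{1,\dots,n\}$, the Kendall-$\tau$ distance $d(\sigma,\pi)$ is the minimum number of adjacent transpositions needed to transform $\sigma$ into $\pi$. For $m<n$, $S_{n,m}$ is the set of permutations of $[1\ldots n]$ in which the symbols $1,\dots,n-m$ appear in increasing order. An $(n,m,d)$-array is a subset of $S_{n,m}$ whose pairwise Kendall-$\tau$ distances are all at least $d$, and $P(n,m,d)$ is the maximum cardinality of an $(n,m,d)$-array. -}

module Defs where

open import Data.Nat using (ℕ; zero; suc; _<_; _≤?_; _∸_)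
open import Data.List using (List; []; _∷_; map; upTo; filter; length)
open import Data.List.Relation.Binary.Permutation.Propositional using (_↭_)
open import Data.List.Relation.Unary.All using (All)
open import Data.List.Relation.Unary.AllPairs using (AllPairs)
open import Data.Product using (_×_; ∃)
open import Relation.Binary.PropositionalEquality using (_≡_; _≢_)
open import Relation.Nullary using (¬_)

-- A permutation of [1..n] is written in one-line notation as a list of
-- naturals that is a rearrangement of [1, 2, ..., n].
[1…_] : ℕ → List ℕ
[1… n ] = map suc (upTo n)

IsPerm : ℕ → List ℕ → Set
IsPerm n σ = σ ↭ [1… n ]

data AdjSwap : List ℕ → List ℕ → Set where
  here  : ∀ {x y xs} → AdjSwap (x ∷ y ∷ xs) (y ∷ x ∷ xs)
  there : ∀ {x xs ys} → AdjSwap xs ys → AdjSwap (x ∷ xs) (x ∷ ys)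

data Steps : ℕ → List ℕ → List ℕ → Set where
  done : ∀ {σ} → Steps zero σ σ
  step : ∀ {k σ τ π} → AdjSwap σ τ → Steps k τ π → Steps (suc k) σ π

KendallAtLeast : ℕ → List ℕ → List ℕ → Set
KendallAtLeast d σ π = ∀ k → k < d → ¬ Steps k σ π

InS : ℕ → ℕ → List ℕ → Set
InS n m σ = IsPerm n σ × filter (_≤? (n ∸ m)) σ ≡ [1… n ∸ m ]

-- An (n,m,d)-array, given as a duplicate-free list of its elements.
IsArray : ℕ → ℕ → ℕ → List (List ℕ) → Set
IsArray n m d A =
  All (InS n m) A × AllPairs (λ σ π → σ ≢ π × KendallAtLeast d σ π) A

PEq : ℕ → ℕ → ℕ → ℕ → Set
PEq n m d k = (∃ λ A → IsArray n m d A × length A ≡ k)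
            × (∀ A → IsArray n m d A → length A Data.Nat.≤ k)

PAtLeast : ℕ → ℕ → ℕ → ℕ → Set
PAtLeast n m d k = ∃ λ A → IsArray n m d A × k Data.Nat.≤ length A

-- A single adjacent transposition changes the number of inversions by at most one, so the
-- identity is at distance at least inv(σ) from any σ.  In S_{n,m} the permutation that lists
-- the m large symbols n, n-1, …, n-m+1 first and then 1, …, n-m has m(n-m) + m(m-1)/2 =
-- mn - m(m+1)/2 inversions.  Conversely, any σ can be turned into any π in S_{n,m} by moving
-- the entries of π to the front one at a time: bringing a small symbol forward only passes
-- large symbols (at most m), bringing a large one forward passes at most the remaining length,
-- and summing these costs gives at most mn - m(m+1)/2 swaps.
module Submission where

open import Defs
open import Data.Nat using (ℕ; suc; _+_; _*_; _∸_; _≤_; _<_)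
open import Data.Nat.DivMod using (_/_)
open import Data.Product using (_×_)

open import Data.Nat using (zero; z≤n; s≤s; _≤?_; _<?_; _≟_)
open import Data.Nat.Properties
open import Data.Nat.DivMod using (m*n/n≡m)
open import Data.Nat.Tactic.RingSolver using (solve-∀)
open import Data.List using (List; []; _∷_; _++_; [_]; upTo; applyUpTo; filter; length)
open import Data.List.Properties
  using (∷-injectiveˡ; ∷-injectiveʳ; ++-identityʳ; length-map; length-upTo; map-upTo; length-++-≤ˡ;
         filter-++; filter-all; filter-none; filter-reject)
open import Data.List.Relation.Unary.All as All using (All; []; _∷_)
open import Data.List.Relation.Unary.AllPairs using ([]; _∷_)
open import Data.List.Relation.Unary.Any using (here; there)
open import Data.List.Membership.Propositional using (_∈_)
open import Data.List.Relation.Binary.Permutation.Propositional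
  using (_↭_; ↭-refl; ↭-sym; ↭-trans; ↭-reflexive; prep; module PermutationReasoning)
open import Data.List.Relation.Binary.Permutation.Propositional.Properties
  using (↭-length; ∈-resp-↭; drop-mid; ↭-empty-inv; ++-comm; ++⁺ʳ)
open import Data.Product using (∃; ∃₂; _,_; proj₁; proj₂)
open import Data.Empty using (⊥-elim)
open import Relation.Nullary using (Dec; yes; no)
open import Relation.Unary using (Decidable)
open import Relation.Binary.PropositionalEquality
  using (_≡_; _≢_; refl; sym; trans; cong; cong₂; subst; module ≡-Reasoning)

Steps-cons : ∀ {k xs ys} x → Steps k xs ys → Steps k (x ∷ xs) (x ∷ ys)
Steps-cons x done        = done
Steps-cons x (step s st) = step (there s) (Steps-cons x st)

Steps-trans : ∀ {a b σ τ π} → Steps a σ τ → Steps b τ π → Steps (a + b) σ π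
Steps-trans done        st′ = st′
Steps-trans (step s st) st′ = step s (Steps-trans st st′)

moveToFront : ∀ xs p ys → Steps (length xs) (xs ++ p ∷ ys) (p ∷ xs ++ ys)
moveToFront []       p ys = done
moveToFront (x ∷ xs) p ys =
  subst (λ k → Steps k (x ∷ xs ++ p ∷ ys) (p ∷ x ∷ xs ++ ys)) (+-comm (length xs) 1)
    (Steps-trans (Steps-cons x (moveToFront xs p ys)) (step here done))

Steps-moveToFront : ∀ {k p ys π} xs → Steps k (xs ++ ys) π →
                    Steps (length xs + k) (xs ++ p ∷ ys) (p ∷ π)
Steps-moveToFront {p = p} {ys} xs st = Steps-trans (moveToFront xs p ys) (Steps-cons p st)

triangle : ℕ → ℕ
triangle zero    = 0
triangle (suc m) = suc m + triangle m

triangle*2 : ∀ m → triangle m * 2 ≡ m * (m + 1)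
triangle*2 zero    = refl
triangle*2 (suc m) = begin
  (suc m + triangle m) * 2    ≡⟨ *-distribʳ-+ 2 (suc m) (triangle m) ⟩
  suc m * 2 + triangle m * 2  ≡⟨ cong (suc m * 2 +_) (triangle*2 m) ⟩
  suc m * 2 + m * (m + 1)     ≡⟨ expand m ⟩
  suc m * (suc m + 1)         ∎
  where
  open ≡-Reasoning
  expand : ∀ m → suc m * 2 + m * (m + 1) ≡ suc m * (suc m + 1)
  expand = solve-∀

m*[m+1]/2≡triangle : ∀ m → m * (m + 1) / 2 ≡ triangle m
m*[m+1]/2≡triangle m = trans (cong (_/ 2) (sym (triangle*2 m))) (m*n/n≡m (triangle m) 2)

-- Matching on the Dec (rather than on its boolean) keeps `y <? x` as a subterm of
-- countBelow's unfolding, so proofs can case split on it with `with y <? x`.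
sucIf : ∀ {A : Set} → Dec A → ℕ → ℕ
sucIf (yes _) n = suc n
sucIf (no  _) n = n

countBelow : ℕ → List ℕ → ℕ
countBelow x []       = 0
countBelow x (y ∷ ys) = sucIf (y <? x) (countBelow x ys)

inversions : List ℕ → ℕ
inversions []       = 0
inversions (x ∷ xs) = countBelow x xs + inversions xs

countBelow-∷-≤ : ∀ x y ys → countBelow x (y ∷ ys) ≤ suc (countBelow x ys)
countBelow-∷-≤ x y ys with y <? x
... | yes _ = ≤-refl
... | no  _ = n≤1+n _

countBelow-∷-≥ : ∀ x y ys → countBelow x ys ≤ countBelow x (y ∷ ys)
countBelow-∷-≥ x y ys with y <? x
... | yes _ = n≤1+n _
... | no  _ = ≤-refl

countBelow-AdjSwap : ∀ {xs ys} z → AdjSwap xs ys → countBelow z ys ≡ countBelow z xs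
countBelow-AdjSwap {x ∷ y ∷ _} z here with x <? z | y <? z
... | yes _ | yes _ = refl
... | yes _ | no  _ = refl
... | no  _ | yes _ = refl
... | no  _ | no  _ = refl
countBelow-AdjSwap {x ∷ _} z (there s) with x <? z
... | yes _ = cong suc (countBelow-AdjSwap z s)
... | no  _ = countBelow-AdjSwap z s

countBelow-++ : ∀ x xs ys → countBelow x (xs ++ ys) ≡ countBelow x xs + countBelow x ys
countBelow-++ x []       ys = refl
countBelow-++ x (y ∷ xs) ys with y <? x
... | yes _ = cong suc (countBelow-++ x xs ys)
... | no  _ = countBelow-++ x xs ys

countBelow-all< : ∀ {x ys} → All (_< x) ys → countBelow x ys ≡ length ys
countBelow-all< {x} []                  = refl
countBelow-all< {x} (_∷_ {y} y<x ys<x) with y <? x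
... | yes _   = cong suc (countBelow-all< ys<x)
... | no  y≮x = ⊥-elim (y≮x y<x)

countBelow-all≥ : ∀ {x ys} → All (x ≤_) ys → countBelow x ys ≡ 0
countBelow-all≥ {x} []                  = refl
countBelow-all≥ {x} (_∷_ {y} x≤y x≤ys) with y <? x
... | yes y<x = ⊥-elim (<⇒≱ y<x x≤y)
... | no  _   = countBelow-all≥ x≤ys

inversions-AdjSwap : ∀ {σ τ} → AdjSwap σ τ → inversions τ ≤ suc (inversions σ)
inversions-AdjSwap {x ∷ y ∷ xs} here = begin
  countBelow y (x ∷ xs) + (countBelow x xs + inversions xs)
    ≤⟨ +-monoˡ-≤ _ (countBelow-∷-≤ y x xs) ⟩
  suc (countBelow y xs + (countBelow x xs + inversions xs))
    ≡⟨ cong suc (+-exchange (countBelow y xs) (countBelow x xs) (inversions xs)) ⟩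
  suc (countBelow x xs + (countBelow y xs + inversions xs))
    ≤⟨ s≤s (+-monoˡ-≤ _ (countBelow-∷-≥ x y xs)) ⟩
  suc (countBelow x (y ∷ xs) + (countBelow y xs + inversions xs)) ∎
  where
  open ≤-Reasoning
  +-exchange : ∀ a b c → a + (b + c) ≡ b + (a + c)
  +-exchange = solve-∀
inversions-AdjSwap {x ∷ xs} {x ∷ ys} (there s) = begin
  countBelow x ys + inversions ys        ≡⟨ cong (_+ inversions ys) (countBelow-AdjSwap x s) ⟩
  countBelow x xs + inversions ys        ≤⟨ +-monoʳ-≤ (countBelow x xs) (inversions-AdjSwap s) ⟩
  countBelow x xs + suc (inversions xs)  ≡⟨ +-suc (countBelow x xs) (inversions xs) ⟩
  suc (countBelow x xs + inversions xs)  ∎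
  where open ≤-Reasoning

inversions-Steps : ∀ {k σ π} → Steps k σ π → inversions π ≤ k + inversions σ
inversions-Steps done                      = ≤-refl
inversions-Steps {suc k} {σ} {π} (step {τ = τ} s st) = begin
  inversions π            ≤⟨ inversions-Steps st ⟩
  k + inversions τ        ≤⟨ +-monoʳ-≤ k (inversions-AdjSwap s) ⟩
  k + suc (inversions σ)  ≡⟨ +-suc k (inversions σ) ⟩
  suc k + inversions σ    ∎
  where open ≤-Reasoning

KendallAtLeast-inversions : ∀ {d σ π} → inversions σ ≡ 0 → d ≤ inversions π →
                            KendallAtLeast d σ π
KendallAtLeast-inversions {d} {σ} {π} inv-σ≡0 d≤inv-π k k<d st = <-irrefl refl (begin-strict
  k                 <⟨ k<d ⟩
  d                 ≤⟨ d≤inv-π ⟩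
  inversions π      ≤⟨ inversions-Steps st ⟩
  k + inversions σ  ≡⟨ cong (k +_) inv-σ≡0 ⟩
  k + 0             ≡⟨ +-identityʳ k ⟩
  k                 ∎)
  where open ≤-Reasoning

inversions-++ : ∀ {t} xs ys → All (t <_) xs → All (_≤ t) ys →
                inversions (xs ++ ys) ≡ inversions xs + length xs * length ys + inversions ys
inversions-++ []       ys []           _    = refl
inversions-++ (x ∷ xs) ys (t<x ∷ t<xs) ys≤t = begin
  countBelow x (xs ++ ys) + inversions (xs ++ ys)
    ≡⟨ cong₂ _+_ (countBelow-++ x xs ys) (inversions-++ xs ys t<xs ys≤t) ⟩
  (countBelow x xs + countBelow x ys) + (inversions xs + length xs * length ys + inversions ys)
    ≡⟨ cong (λ c → (countBelow x xs + c) + _) ys-below-x ⟩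
  (countBelow x xs + length ys) + (inversions xs + length xs * length ys + inversions ys)
    ≡⟨ regroup (countBelow x xs) (length ys) (inversions xs) (length xs) (inversions ys) ⟩
  countBelow x xs + inversions xs + suc (length xs) * length ys + inversions ys ∎
  where
  open ≡-Reasoning
  ys-below-x : countBelow x ys ≡ length ys
  ys-below-x = countBelow-all< (All.map (λ y≤t → ≤-<-trans y≤t t<x) ys≤t)
  regroup : ∀ c l i k j → (c + l) + (i + k * l + j) ≡ c + i + suc k * l + j
  regroup = solve-∀

ascending : ℕ → ℕ → List ℕ
ascending a zero    = []
ascending a (suc n) = suc a ∷ ascending (suc a) n

descending : ℕ → ℕ → List ℕ
descending a zero    = []
descending a (suc n) = suc (a + n) ∷ descending a n

length-ascending : ∀ a n → length (ascending a n) ≡ n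
length-ascending a zero    = refl
length-ascending a (suc n) = cong suc (length-ascending (suc a) n)

length-descending : ∀ a n → length (descending a n) ≡ n
length-descending a zero    = refl
length-descending a (suc n) = cong suc (length-descending a n)

ascending-above : ∀ a n → All (a <_) (ascending a n)
ascending-above a zero    = []
ascending-above a (suc n) = ≤-refl ∷ All.map (<-trans (n<1+n a)) (ascending-above (suc a) n)

ascending-below : ∀ a n → All (_≤ a + n) (ascending a n)
ascending-below a zero = []
ascending-below a (suc n) rewrite +-suc a n = s≤s (m≤m+n a n) ∷ ascending-below (suc a) n

descending-above : ∀ a n → All (a <_) (descending a n)
descending-above a zero    = []
descending-above a (suc n) = s≤s (m≤m+n a n) ∷ descending-above a n

descending-below : ∀ a n → All (_≤ a + n) (descending a n)
descending-below a zero = []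
descending-below a (suc n) rewrite +-suc a n =
  ≤-refl ∷ All.map m≤n⇒m≤1+n (descending-below a n)

ascending-++ : ∀ a i j → ascending a (i + j) ≡ ascending a i ++ ascending (a + i) j
ascending-++ a zero    j rewrite +-identityʳ a = refl
ascending-++ a (suc i) j rewrite +-suc a i = cong (suc a ∷_) (ascending-++ (suc a) i j)

descending↭ascending : ∀ a n → descending a n ↭ ascending a n
descending↭ascending a zero    = ↭-refl
descending↭ascending a (suc n) = begin
  suc (a + n) ∷ descending a n   ↭⟨ prep (suc (a + n)) (descending↭ascending a n) ⟩
  suc (a + n) ∷ ascending a n    ↭⟨ ++-comm [ suc (a + n) ] (ascending a n) ⟩
  ascending a n ++ [ suc (a + n) ] ≡⟨ ascending-++ a n 1 ⟨
  ascending a (n + 1)            ≡⟨ cong (ascending a) (+-comm n 1) ⟩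
  ascending a (suc n)            ∎
  where open PermutationReasoning

applyUpTo-ascending : ∀ {f} a n → (∀ i → f i ≡ suc (a + i)) → applyUpTo f n ≡ ascending a n
applyUpTo-ascending a zero    f≗ = refl
applyUpTo-ascending a (suc n) f≗ =
  cong₂ _∷_ (trans (f≗ 0) (cong suc (+-identityʳ a)))
            (applyUpTo-ascending (suc a) n (λ i → trans (f≗ (suc i)) (cong suc (+-suc a i))))

[1…]≡ascending : ∀ n → [1… n ] ≡ ascending 0 n
[1…]≡ascending n = trans (map-upTo suc n) (applyUpTo-ascending 0 n (λ _ → refl))

inversions-ascending : ∀ a n → inversions (ascending a n) ≡ 0
inversions-ascending a zero    = refl
inversions-ascending a (suc n) =
  cong₂ _+_ (countBelow-all≥ (All.map <⇒≤ (ascending-above (suc a) n)))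
            (inversions-ascending (suc a) n)

inversions-descending : ∀ a n → inversions (descending a n) + n ≡ triangle n
inversions-descending a zero    = refl
inversions-descending a (suc n) = begin
  countBelow (suc (a + n)) (descending a n) + inversions (descending a n) + suc n
    ≡⟨ cong (λ c → c + inversions (descending a n) + suc n) countBelow-top ⟩
  n + inversions (descending a n) + suc n
    ≡⟨ regroup n (inversions (descending a n)) ⟩
  suc n + (inversions (descending a n) + n)
    ≡⟨ cong (suc n +_) (inversions-descending a n) ⟩
  suc n + triangle n ∎
  where
  open ≡-Reasoning
  countBelow-top : countBelow (suc (a + n)) (descending a n) ≡ n
  countBelow-top = trans (countBelow-all< (All.map s≤s (descending-below a n))) (length-descending a n)
  regroup : ∀ n i → n + i + suc n ≡ suc n + (i + n)
  regroup = solve-∀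

∈-∃++-first : ∀ {p : ℕ} {σ} → p ∈ σ → ∃₂ λ xs ys → σ ≡ xs ++ p ∷ ys × All (_≢ p) xs
∈-∃++-first {p} {x ∷ σ} p∈ with x ≟ p
... | yes refl = [] , σ , refl , []
∈-∃++-first (here p≡x) | no x≢p = ⊥-elim (x≢p (sym p≡x))
∈-∃++-first (there p∈) | no x≢p with ∈-∃++-first p∈
... | xs , ys , refl , xs≢p = _ ∷ xs , ys , refl , x≢p ∷ xs≢p

reorder-cost-accepted : ∀ {c k b L} → c ≤ b → k + triangle b ≤ b * L →
                        (c + k) + triangle b ≤ b * suc L
reorder-cost-accepted {c} {k} {b} {L} c≤b bound = begin
  (c + k) + triangle b  ≡⟨ +-assoc c k (triangle b) ⟩
  c + (k + triangle b)  ≤⟨ +-mono-≤ c≤b bound ⟩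
  b + b * L             ≡⟨ *-suc b L ⟨
  b * suc L             ∎
  where open ≤-Reasoning

reorder-cost-rejected : ∀ {c k b L} → c ≤ L → k + triangle b ≤ b * L →
                        (c + k) + triangle (suc b) ≤ suc b * suc L
reorder-cost-rejected {c} {k} {b} {L} c≤L bound = begin
  (c + k) + (suc b + triangle b)  ≡⟨ regroup c k b (triangle b) ⟩
  (c + suc b) + (k + triangle b)  ≤⟨ +-mono-≤ (+-monoˡ-≤ (suc b) c≤L) bound ⟩
  (L + suc b) + b * L             ≡⟨ expand b L ⟩
  suc b * suc L                   ∎
  where
  open ≤-Reasoning
  regroup : ∀ c k b T → (c + k) + (suc b + T) ≡ (c + suc b) + (k + T)
  regroup = solve-∀
  expand : ∀ b L → (L + suc b) + b * L ≡ suc b * suc L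
  expand = solve-∀

module _ {P : ℕ → Set} (P? : Decidable P) where

  rejected : List ℕ → ℕ
  rejected []       = 0
  rejected (x ∷ xs) with P? x
  ... | yes _ = rejected xs
  ... | no  _ = suc (rejected xs)

  rejected-++ : ∀ xs ys → rejected (xs ++ ys) ≡ rejected xs + rejected ys
  rejected-++ []       ys = refl
  rejected-++ (x ∷ xs) ys with P? x
  ... | yes _ = rejected-++ xs ys
  ... | no  _ = cong suc (rejected-++ xs ys)

  rejected+length-filter : ∀ xs → rejected xs + length (filter P? xs) ≡ length xs
  rejected+length-filter []       = refl
  rejected+length-filter (x ∷ xs) with P? x
  ... | yes _ = trans (+-suc (rejected xs) _) (cong suc (rejected+length-filter xs))
  ... | no  _ = cong suc (rejected+length-filter xs)

  rejected-cong : ∀ {xs ys} → length xs ≡ length ys → filter P? xs ≡ filter P? ys →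
                  rejected xs ≡ rejected ys
  rejected-cong {xs} {ys} length≡ filter≡ = +-cancelʳ-≡ _ (rejected xs) (rejected ys) (begin
    rejected xs + length (filter P? xs)  ≡⟨ rejected+length-filter xs ⟩
    length xs                            ≡⟨ length≡ ⟩
    length ys                            ≡⟨ rejected+length-filter ys ⟨
    rejected ys + length (filter P? ys)  ≡⟨ cong (λ zs → rejected ys + length zs) filter≡ ⟨
    rejected ys + length (filter P? xs)  ∎)
    where open ≡-Reasoning

  rejected-filter-[] : ∀ xs → filter P? xs ≡ [] → rejected xs ≡ length xs
  rejected-filter-[] xs filter≡[] = begin
    rejected xs                          ≡⟨ +-identityʳ (rejected xs) ⟨
    rejected xs + length {A = ℕ} []      ≡⟨ cong (λ zs → rejected xs + length zs) filter≡[] ⟨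
    rejected xs + length (filter P? xs)  ≡⟨ rejected+length-filter xs ⟩
    length xs                            ∎
    where open ≡-Reasoning

  filter-++-first : ∀ {p r} xs ys → All (_≢ p) xs → P p →
                    filter P? (xs ++ p ∷ ys) ≡ p ∷ r → filter P? xs ≡ [] × filter P? ys ≡ r
  filter-++-first {p} [] ys [] px filter≡ with P? p
  ... | yes _  = refl , ∷-injectiveʳ filter≡
  ... | no ¬px = ⊥-elim (¬px px)
  filter-++-first (x ∷ xs) ys (x≢p ∷ xs≢p) px filter≡ with P? x
  ... | yes _ = ⊥-elim (x≢p (∷-injectiveˡ filter≡))
  ... | no  _ = filter-++-first xs ys xs≢p px filter≡

  reorder : ∀ σ π → σ ↭ π → filter P? σ ≡ filter P? π →
            ∃ λ k → Steps k σ π × k + triangle (rejected π) ≤ rejected π * length π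
  reorder σ [] σ↭[] _ rewrite ↭-empty-inv σ↭[] = 0 , done , z≤n
  reorder σ (p ∷ π) σ↭ filter≡ with ∈-∃++-first (∈-resp-↭ (↭-sym σ↭) (here refl))
  ... | xs , ys , refl , xs≢p with P? p
  ... | yes px =
    let k , st , bound = reorder (xs ++ ys) π rest↭π filter-rest
    in length xs + k , Steps-moveToFront xs st , reorder-cost-accepted xs≤rejected bound
    where
    rest↭π : xs ++ ys ↭ π
    rest↭π = drop-mid xs [] σ↭
    split : filter P? xs ≡ [] × filter P? ys ≡ filter P? π
    split = filter-++-first xs ys xs≢p px filter≡
    filter-rest : filter P? (xs ++ ys) ≡ filter P? π
    filter-rest = trans (filter-++ P? xs ys) (cong₂ _++_ (proj₁ split) (proj₂ split))
    -- p is the first accepted entry of σ, so everything it passes is rejected.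
    xs≤rejected : length xs ≤ rejected π
    xs≤rejected = begin
      length xs                  ≡⟨ rejected-filter-[] xs (proj₁ split) ⟨
      rejected xs                ≤⟨ m≤m+n (rejected xs) (rejected ys) ⟩
      rejected xs + rejected ys  ≡⟨ rejected-++ xs ys ⟨
      rejected (xs ++ ys)        ≡⟨ rejected-cong {xs ++ ys} {π} (↭-length rest↭π) filter-rest ⟩
      rejected π                 ∎
      where open ≤-Reasoning
  ... | no ¬px =
    let k , st , bound = reorder (xs ++ ys) π rest↭π filter-rest
    in length xs + k , Steps-moveToFront xs st , reorder-cost-rejected {b = rejected π} xs≤length bound
    where
    rest↭π : xs ++ ys ↭ π
    rest↭π = drop-mid xs [] σ↭
    filter-rest : filter P? (xs ++ ys) ≡ filter P? π
    filter-rest = begin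
      filter P? (xs ++ ys)                ≡⟨ filter-++ P? xs ys ⟩
      filter P? xs ++ filter P? ys        ≡⟨ cong (filter P? xs ++_) (filter-reject P? ¬px) ⟨
      filter P? xs ++ filter P? (p ∷ ys)  ≡⟨ filter-++ P? xs (p ∷ ys) ⟨
      filter P? (xs ++ p ∷ ys)            ≡⟨ filter≡ ⟩
      filter P? π                         ∎
      where open ≡-Reasoning
    xs≤length : length xs ≤ length π
    xs≤length = ≤-trans (length-++-≤ˡ xs) (≤-reflexive (↭-length rest↭π))

module _ {t : ℕ} {xs ys : List ℕ} (xs≤t : All (_≤ t) xs) (t<ys : All (t <_) ys) where

  private
    filter-small : filter (_≤? t) xs ≡ xs
    filter-small = filter-all (_≤? t) xs≤t

    filter-large : filter (_≤? t) ys ≡ []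
    filter-large = filter-none (_≤? t) (All.map <⇒≱ t<ys)

  filter-small++large : filter (_≤? t) (xs ++ ys) ≡ xs
  filter-small++large = begin
    filter (_≤? t) (xs ++ ys)               ≡⟨ filter-++ (_≤? t) xs ys ⟩
    filter (_≤? t) xs ++ filter (_≤? t) ys  ≡⟨ cong₂ _++_ filter-small filter-large ⟩
    xs ++ []                                ≡⟨ ++-identityʳ xs ⟩
    xs                                      ∎
    where open ≡-Reasoning

  filter-large++small : filter (_≤? t) (ys ++ xs) ≡ xs
  filter-large++small = begin
    filter (_≤? t) (ys ++ xs)               ≡⟨ filter-++ (_≤? t) ys xs ⟩
    filter (_≤? t) ys ++ filter (_≤? t) xs  ≡⟨ cong₂ _++_ filter-large filter-small ⟩
    xs                                      ∎
    where open ≡-Reasoning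

length-[1…] : ∀ n → length [1… n ] ≡ n
length-[1…] n = trans (length-map suc (upTo n)) (length-upTo n)

inversions-[1…] : ∀ n → inversions [1… n ] ≡ 0
inversions-[1…] n = trans (cong inversions ([1…]≡ascending n)) (inversions-ascending 0 n)

length-InS : ∀ {n m σ} → InS n m σ → length σ ≡ n
length-InS {n} (σ↭ , _) = trans (↭-length σ↭) (length-[1…] n)

largeFirst : ℕ → ℕ → List ℕ
largeFirst n m = descending (n ∸ m) m ++ ascending 0 (n ∸ m)

module _ {n m : ℕ} (m≤n : m ≤ n) where

  private
    t : ℕ
    t = n ∸ m

    t+m≡n : t + m ≡ n
    t+m≡n = m∸n+n≡m m≤n

  [1…]-split : [1… n ] ≡ ascending 0 t ++ ascending t m
  [1…]-split = begin
    [1… n ]                         ≡⟨ [1…]≡ascending n ⟩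
    ascending 0 n                   ≡⟨ cong (ascending 0) t+m≡n ⟨
    ascending 0 (t + m)             ≡⟨ ascending-++ 0 t m ⟩
    ascending 0 t ++ ascending t m  ∎
    where open ≡-Reasoning

  [1…]-InS : InS n m [1… n ]
  [1…]-InS = ↭-refl , (begin
    filter (_≤? t) [1… n ]
      ≡⟨ cong (filter (_≤? t)) [1…]-split ⟩
    filter (_≤? t) (ascending 0 t ++ ascending t m)
      ≡⟨ filter-small++large (ascending-below 0 t) (ascending-above t m) ⟩
    ascending 0 t
      ≡⟨ [1…]≡ascending t ⟨
    [1… t ] ∎)
    where open ≡-Reasoning

  largeFirst-InS : InS n m (largeFirst n m)
  largeFirst-InS = largeFirst↭ , (begin
    filter (_≤? t) (descending t m ++ ascending 0 t)
      ≡⟨ filter-large++small (ascending-below 0 t) (descending-above t m) ⟩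
    ascending 0 t
      ≡⟨ [1…]≡ascending t ⟨
    [1… t ] ∎)
    where
    open ≡-Reasoning
    largeFirst↭ : largeFirst n m ↭ [1… n ]
    largeFirst↭ = ↭-trans (++⁺ʳ (ascending 0 t) (descending↭ascending t m))
                  (↭-trans (++-comm (ascending t m) (ascending 0 t)) (↭-reflexive (sym [1…]-split)))

  triangle+inversions-largeFirst : triangle m + inversions (largeFirst n m) ≡ m * n
  triangle+inversions-largeFirst = +-cancelʳ-≡ m _ _ (begin
    triangle m + inversions (largeFirst n m) + m
      ≡⟨ cong (λ i → triangle m + i + m) inversions-split ⟩
    triangle m + (D + m * t + 0) + m
      ≡⟨ regroup (triangle m) D m t ⟩
    triangle m + ((D + m) + m * t)
      ≡⟨ cong (λ x → triangle m + (x + m * t)) (inversions-descending t m) ⟩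
    triangle m + (triangle m + m * t)
      ≡⟨ +-assoc (triangle m) (triangle m) (m * t) ⟨
    triangle m + triangle m + m * t
      ≡⟨ cong (_+ m * t) (trans (double (triangle m)) (triangle*2 m)) ⟩
    m * (m + 1) + m * t
      ≡⟨ expand m t ⟩
    m * (t + m) + m
      ≡⟨ cong (λ x → m * x + m) t+m≡n ⟩
    m * n + m ∎)
    where
    open ≡-Reasoning
    D : ℕ
    D = inversions (descending t m)
    inversions-split : inversions (largeFirst n m) ≡ D + m * t + 0
    inversions-split = begin
      inversions (largeFirst n m)
        ≡⟨ inversions-++ (descending t m) (ascending 0 t) (descending-above t m) (ascending-below 0 t) ⟩
      D + length (descending t m) * length (ascending 0 t) + inversions (ascending 0 t)
        ≡⟨ cong₂ (λ l i → D + l + i) (cong₂ _*_ (length-descending t m) (length-ascending 0 t))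
                 (inversions-ascending 0 t) ⟩
      D + m * t + 0 ∎
    regroup : ∀ T D m t → T + (D + m * t + 0) + m ≡ T + ((D + m) + m * t)
    regroup = solve-∀
    double : ∀ T → T + T ≡ T * 2
    double = solve-∀
    expand : ∀ m t → m * (m + 1) + m * t ≡ m * (t + m) + m
    expand = solve-∀

  inversions-largeFirst : inversions (largeFirst n m) ≡ m * n ∸ m * (m + 1) / 2
  inversions-largeFirst = begin
    inversions (largeFirst n m)
      ≡⟨ m+n∸m≡n (triangle m) _ ⟨
    triangle m + inversions (largeFirst n m) ∸ triangle m
      ≡⟨ cong₂ _∸_ triangle+inversions-largeFirst (sym (m*[m+1]/2≡triangle m)) ⟩
    m * n ∸ m * (m + 1) / 2 ∎
    where open ≡-Reasoning

  rejected-InS : ∀ {σ} → InS n m σ → rejected (_≤? t) σ ≡ m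
  rejected-InS {σ} σ∈@(_ , filter≡) = +-cancelʳ-≡ t _ _ (begin
    rejected (_≤? t) σ + t
      ≡⟨ cong (rejected (_≤? t) σ +_) (trans (cong length filter≡) (length-[1…] t)) ⟨
    rejected (_≤? t) σ + length (filter (_≤? t) σ)  ≡⟨ rejected+length-filter (_≤? t) σ ⟩
    length σ                                        ≡⟨ length-InS {m = m} σ∈ ⟩
    n                                               ≡⟨ t+m≡n ⟨
    t + m                                           ≡⟨ +-comm t m ⟩
    m + t                                           ∎)
    where open ≡-Reasoning

  InS-diameter : ∀ {σ π} → InS n m σ → InS n m π →
                 ∃ λ k → Steps k σ π × k ≤ m * n ∸ m * (m + 1) / 2
  InS-diameter {σ} {π} (σ↭ , σ-filter) π∈@(π↭ , π-filter)
    with reorder (_≤? t) σ π (↭-trans σ↭ (↭-sym π↭)) (trans σ-filter (sym π-filter))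
  ... | k , st , bound = k , st , (begin
    k
      ≤⟨ m+n≤o⇒m≤o∸n k bound ⟩
    b * length π ∸ triangle b
      ≡⟨ cong₂ (λ b L → b * L ∸ triangle b) (rejected-InS π∈) (length-InS {m = m} π∈) ⟩
    m * n ∸ triangle m
      ≡⟨ cong (m * n ∸_) (m*[m+1]/2≡triangle m) ⟨
    m * n ∸ m * (m + 1) / 2 ∎)
    where
    open ≤-Reasoning
    b : ℕ
    b = rejected (_≤? t) π

proposition1 : (n m d : ℕ) → 1 ≤ m → m < n → 1 ≤ d →
    (d ≤ m * n ∸ (m * (m + 1)) / 2 → PAtLeast n m d 2)
    × (m * n ∸ (m * (m + 1)) / 2 < d → PEq n m d 1)
proposition1 n m d _ m<n 1≤d = atLeastTwo , exactlyOne
  where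
  m≤n = <⇒≤ m<n

  far : d ≤ m * n ∸ (m * (m + 1)) / 2 → KendallAtLeast d [1… n ] (largeFirst n m)
  far d≤ = KendallAtLeast-inversions (inversions-[1…] n)
             (subst (d ≤_) (sym (inversions-largeFirst m≤n)) d≤)

  atLeastTwo : d ≤ m * n ∸ (m * (m + 1)) / 2 → PAtLeast n m d 2
  atLeastTwo d≤ =
    [1… n ] ∷ largeFirst n m ∷ [] ,
    ([1…]-InS m≤n ∷ largeFirst-InS m≤n ∷ [] , ((distinct , far d≤) ∷ []) ∷ [] ∷ []) ,
    ≤-refl
    where
    distinct : [1… n ] ≢ largeFirst n m
    distinct eq = far d≤ 0 1≤d (subst (Steps 0 [1… n ]) eq done)

  exactlyOne : m * n ∸ (m * (m + 1)) / 2 < d → PEq n m d 1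
  exactlyOne bound<d = ([1… n ] ∷ [] , ([1…]-InS m≤n ∷ [] , [] ∷ []) , refl) , atMostOne
    where
    atMostOne : ∀ A → IsArray n m d A → length A ≤ 1
    atMostOne []          _ = z≤n
    atMostOne (_ ∷ [])    _ = ≤-refl
    atMostOne (_ ∷ _ ∷ _) ((σ∈ ∷ π∈ ∷ _) , ((_ , σπ-far) ∷ _) ∷ _)
      with InS-diameter m≤n σ∈ π∈
    ... | k , st , k≤ = ⊥-elim (σπ-far k (≤-<-trans k≤ bound<d) st)
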